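{- Let $p\ge 0$ be an integer and $A$ a finite set of positive integers with $\gcd(A)=1$; write $\ell_0=\ell_0(p)$ and $g=g_p(A)$. If $S_p(A)=\{n\in\mathbb Z:\ell_0\le n\le g-1\}\cup\{n\in\mathbb Z:n\ge g+1\}$, then $S_p(A)$ is $p$-almost symmetric. Likewise, if $S_p(A)=\{\ell_0\}\cup\{n\in\mathbb Z: n\ge g+1\}$, then $S_p(A)$ is $p$-almost symmetric.
   Context: For $A=\{a_1,\dots,a_k\}$ and $n\ge 0$, $d(n;A)$ is the number of $(x_1,\dots,x_k)\in\mathbb N_0^k$ with $\sum a_ix_i=n$. For $p\ge 0$, $S_p(A)=\{n\in\mathbb N_0:d(n;A)>p\}$, $G_p(A)=\mathbb N_0\setminus S_p(A)$, $g_p(A)=\max G_p(A)$, $\ell_0(p)=\min S_p(A)$. $\mathrm{PF}_p(A)$ is the set of integers $x\notin S_p(A)$ with $x+s-\ell_0(p)\in S_p(A)$ for all $s\in S_p(A)\setminus\{\ell_0(p)\}$. $L_p(A)=\{s\in\mathbb Z: s\notin S_p(A),\ g_p(A)+\ell_0(p)-s\notin S_p(A)\}$. $S_p(A)$ is $p$-almost symmetric if $L_p(A)\subseteq\mathrm{PF}_p(A)$. -}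

module Defs where

open import Data.Nat as ℕ using (ℕ; zero; suc; _≟_)
open import Data.Nat.GCD using (gcd)
open import Data.Integer as ℤ using (ℤ; +_; _≤_; _<_; _+_; _-_)
open import Data.List using (List; []; _∷_; [_]; map; concatMap; upTo; filter; length)
open import Data.Vec using (Vec; lookup; zipWith; foldr′)
import Data.Vec as V
open import Data.Fin using (Fin)
open import Data.Product using (Σ; _×_)
open import Relation.Nullary using (¬_)
open import Relation.Binary.PropositionalEquality using (_≡_; _≢_)

dot : ∀ {k} → Vec ℕ k → Vec ℕ k → ℕ
dot A x = foldr′ ℕ._+_ 0 (zipWith ℕ._*_ A x)

box : (k b : ℕ) → List (Vec ℕ k)
box zero    b = [ V.[] ]
box (suc k) b = concatMap (λ x → map (x V.∷_) (box k b)) (upTo (suc b))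

-- d(n;A) = #{x ∈ ℕ₀^k : Σ aᵢ xᵢ = n}.  Since all aᵢ ≥ 1, every solution has
-- xᵢ ≤ n, so it suffices to count solutions inside the box {0,…,n}^k.
d : ∀ {k} → ℕ → Vec ℕ k → ℕ
d n A = length (filter (λ x → dot A x ≟ n) (box _ n))

gcdVec : ∀ {k} → Vec ℕ k → ℕ
gcdVec = foldr′ gcd 0

InS : ℕ → ∀ {k} → Vec ℕ k → ℤ → Set
InS p A z = Σ ℕ (λ n → (z ≡ + n) × (p ℕ.< d n A))

IsMinS : ℕ → ∀ {k} → Vec ℕ k → ℤ → Set
IsMinS p A ℓ = InS p A ℓ × (∀ n → n < ℓ → ¬ InS p A n)

-- g is g_p(A) = max G_p(A): the largest integer not in S_p(A)
-- (negative integers are never in S_p(A); this gives g = -1 when G_p(A) = ∅)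
IsFrob : ℕ → ∀ {k} → Vec ℕ k → ℤ → Set
IsFrob p A g = ¬ InS p A g × (∀ n → g < n → InS p A n)

InPF : ℕ → ∀ {k} → Vec ℕ k → ℤ → ℤ → Set
InPF p A ℓ x = ¬ InS p A x × (∀ s → InS p A s → s ≢ ℓ → InS p A (x + s - ℓ))

InL : ℕ → ∀ {k} → Vec ℕ k → ℤ → ℤ → ℤ → Set
InL p A ℓ g s = ¬ InS p A s × ¬ InS p A (g + ℓ - s)

AlmostSym : ℕ → ∀ {k} → Vec ℕ k → ℤ → ℤ → Set
AlmostSym p A ℓ g = ∀ s → InL p A ℓ g s → InPF p A ℓ s

module Submission where

-- Every s ∈ L_p(A) lies in [ℓ₀, g]: s ∉ S forces s ≤ g, and g + ℓ₀ - s ∉ S forces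
-- g + ℓ₀ - s ≤ g.  If the only gap of S in [ℓ₀, g] is g itself, then s = g and
-- g + ℓ₀ - s = ℓ₀ ∈ S, so L_p(A) is empty.  If S ∩ (ℓ₀, g] is empty, any
-- s ≥ ℓ₀ and t ∈ S ∖ {ℓ₀} give s + t - ℓ₀ ≥ t > g, so s ∈ PF_p(A).

open import Defs
open import Data.Nat using (ℕ)
open import Data.Integer using (ℤ; +_; _≤_; _<_; _+_; _-_; -_; _≤?_)
open import Data.Integer.Properties
  using (≤-antisym; ≮⇒≥; ≰⇒>; +-comm; +-mono-≤; +-monoˡ-≤; i<j⇒suc[i]≤j; suc[i]≤j⇒i<j)
open import Data.Integer.Tactic.RingSolver using (solve-∀)
open import Data.Vec using (Vec; lookup)
open import Data.Product using (_×_; _,_; proj₂)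
open import Data.Sum using (_⊎_; inj₁; inj₂)
open import Function.Bundles using (_⇔_; module Equivalence)
open import Function.Definitions using (Injective)
open import Relation.Nullary using (¬_; contradiction; yes; no)
open import Relation.Binary.PropositionalEquality using (_≡_; _≢_; subst; subst₂; sym)

i+j-k≤i⇒j≤k : ∀ i j k → i + j - k ≤ i → j ≤ k
i+j-k≤i⇒j≤k i j k h = subst₂ _≤_ (cancel i j k) (+-cancel i k) (+-monoˡ-≤ (k - i) h)
  where
  cancel : ∀ i j k → (i + j - k) + (k - i) ≡ j
  cancel = solve-∀
  +-cancel : ∀ i k → i + (k - i) ≡ k
  +-cancel = solve-∀

i≰j-1⇒j≤i : ∀ i j → ¬ i ≤ j - + 1 → j ≤ i
i≰j-1⇒j≤i i j h = subst (_≤ i) (suc-pred j) (i<j⇒suc[i]≤j (≰⇒> h))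
  where
  suc-pred : ∀ j → + 1 + (j - + 1) ≡ j
  suc-pred = solve-∀

k≤m∧i<j⇒i<m+j-k : ∀ {i j k m} → k ≤ m → i < j → i < m + j - k
k≤m∧i<j⇒i<m+j-k {i} {j} {k} {m} k≤m i<j =
  suc[i]≤j⇒i<j (subst (_≤ m + j - k) (shift i j k)
    (+-monoˡ-≤ (- k) (+-mono-≤ k≤m (i<j⇒suc[i]≤j i<j))))
  where
  shift : ∀ i j k → k + (+ 1 + i) - k ≡ + 1 + i
  shift = solve-∀

module _ (p : ℕ) {k} (A : Vec ℕ k) (ℓ₀ g : ℤ) (frob : IsFrob p A g) where

  private
    S = InS p A
    >frob⇒∈S : ∀ n → g < n → S n
    >frob⇒∈S = proj₂ frob

  ∉S⇒≤frob : ∀ {s} → ¬ S s → s ≤ g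
  ∉S⇒≤frob s∉S = ≮⇒≥ λ g<s → s∉S (>frob⇒∈S _ g<s)

  InL⇒ℓ₀≤ : ∀ {s} → InL p A ℓ₀ g s → ℓ₀ ≤ s
  InL⇒ℓ₀≤ {s} (_ , mirror∉S) = i+j-k≤i⇒j≤k g ℓ₀ s (∉S⇒≤frob mirror∉S)

  InL⇒≡frob : (∀ n → S n ⇔ ((ℓ₀ ≤ n × n ≤ g - + 1) ⊎ g + + 1 ≤ n)) →
              ∀ {s} → InL p A ℓ₀ g s → s ≡ g
  InL⇒≡frob S⇔ {s} L@(s∉S , _) with s ≤? g - + 1
  ... | yes s≤g-1 = contradiction (Equivalence.from (S⇔ s) (inj₁ (InL⇒ℓ₀≤ L , s≤g-1))) s∉S
  ... | no  s≰g-1 = ≤-antisym (∉S⇒≤frob s∉S) (i≰j-1⇒j≤i s g s≰g-1)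

  almostSym-gapOnlyAtFrob : S ℓ₀ → (∀ n → S n ⇔ ((ℓ₀ ≤ n × n ≤ g - + 1) ⊎ g + + 1 ≤ n)) →
                            AlmostSym p A ℓ₀ g
  almostSym-gapOnlyAtFrob ℓ₀∈S S⇔ s L@(_ , mirror∉S) =
    contradiction (subst S (sym mirror≡ℓ₀) ℓ₀∈S) mirror∉S
    where
    g+ℓ-g≡ℓ : ∀ g ℓ → g + ℓ - g ≡ ℓ
    g+ℓ-g≡ℓ = solve-∀
    mirror≡ℓ₀ : g + ℓ₀ - s ≡ ℓ₀
    mirror≡ℓ₀ rewrite InL⇒≡frob S⇔ L = g+ℓ-g≡ℓ g ℓ₀

  almostSym-noElementsBelowFrob : (∀ n → S n ⇔ (n ≡ ℓ₀ ⊎ g + + 1 ≤ n)) → AlmostSym p A ℓ₀ g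
  almostSym-noElementsBelowFrob S⇔ s L@(s∉S , _) = s∉S , translate
    where
    translate : ∀ t → S t → t ≢ ℓ₀ → S (s + t - ℓ₀)
    translate t t∈S t≢ℓ₀ with Equivalence.to (S⇔ t) t∈S
    ... | inj₁ t≡ℓ₀  = contradiction t≡ℓ₀ t≢ℓ₀
    ... | inj₂ g+1≤t = >frob⇒∈S _ (k≤m∧i<j⇒i<m+j-k (InL⇒ℓ₀≤ L) g<t)
      where
      g<t : g < t
      g<t = suc[i]≤j⇒i<j (subst (_≤ t) (+-comm g (+ 1)) g+1≤t)

proposition3 : (p k : ℕ) (A : Vec ℕ k) →
    (∀ i → 0 Data.Nat.< lookup A i) →
    Injective _≡_ _≡_ (lookup A) →
    gcdVec A ≡ 1 →
    (ℓ₀ g : ℤ) → IsMinS p A ℓ₀ → IsFrob p A g →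
    ((∀ n → InS p A n ⇔ ((ℓ₀ ≤ n × n ≤ g - + 1) ⊎ g + + 1 ≤ n)) → AlmostSym p A ℓ₀ g)
    × ((∀ n → InS p A n ⇔ (n ≡ ℓ₀ ⊎ g + + 1 ≤ n)) → AlmostSym p A ℓ₀ g)
proposition3 p k A _ _ _ ℓ₀ g (ℓ₀∈S , _) frob =
  almostSym-gapOnlyAtFrob p A ℓ₀ g frob ℓ₀∈S , almostSym-noElementsBelowFrob p A ℓ₀ g frob
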